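{- Let $G$ be a cubic graph and let $H$ be a subdivision of $G$ in which every edge of $G$ is subdivided at least twice (i.e. each edge of $G$ is replaced by a path with at least two internal vertices). Then $H$ admits a crumby coloring.
   Context: A crumby coloring of a graph $H$ is a coloring of the vertices of $H$ with two colors, red and blue, such that the subgraph induced by the blue vertices has maximum degree at most $1$, and the subgraph induced by the red vertices has minimum degree at least $1$ and contains no path with $3$ edges. A graph is cubic if every vertex has degree $3$. -}

module Defs where

open import Data.Nat using (ℕ; zero; suc; _≤_)
open import Data.Fin using (Fin; toℕ) renaming (_<_ to _<ᶠ_)
open import Data.Bool using (Bool; true; false; if_then_else_)
open import Data.List using (map; allFin)
open import Data.Nat.ListAction using (sum)
open import Data.Product using (Σ; ∃; _×_; _,_; proj₁; proj₂)
open import Data.Sum using (_⊎_; inj₁; inj₂)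
open import Data.Empty using (⊥)
open import Relation.Nullary using (¬_)
open import Relation.Binary.PropositionalEquality using (_≡_)

record SimpleGraph (n : ℕ) : Set where
  field
    adj     : Fin n → Fin n → Bool
    symm    : ∀ u v → adj u v ≡ adj v u
    irrefl  : ∀ v → adj v v ≡ false

open SimpleGraph public

degree : ∀ {n} → SimpleGraph n → Fin n → ℕ
degree {n} G v = sum (map (λ w → if adj G v w then 1 else 0) (allFin n))

Cubic : ∀ {n} → SimpleGraph n → Set
Cubic G = ∀ v → degree G v ≡ 3

-- Edges of G: each edge {u,v} is represented once, as (u , v) with u < v.

Edge : ∀ {n} → SimpleGraph n → Set
Edge {n} G = Σ (Fin n) λ u → Σ (Fin n) λ v → (u <ᶠ v) × (adj G u v ≡ true)

src tgt : ∀ {n} {G : SimpleGraph n} → Edge G → Fin n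
src e = proj₁ e
tgt e = proj₁ (proj₂ e)

-- The subdivision of G in which edge e is replaced by a path
--   src e — (e,0) — (e,1) — … — (e, s e - 1) — tgt e
-- with s e internal (new) vertices.

SubV : ∀ {n} (G : SimpleGraph n) (s : Edge G → ℕ) → Set
SubV {n} G s = Fin n ⊎ Σ (Edge G) (λ e → Fin (s e))

data SubArc {n} (G : SimpleGraph n) (s : Edge G → ℕ) : SubV G s → SubV G s → Set where
  direct : (e : Edge G) → s e ≡ 0 →
           SubArc G s (inj₁ (src {G = G} e)) (inj₁ (tgt {G = G} e))
  start  : (e : Edge G) (i : Fin (s e)) → toℕ i ≡ 0 →
           SubArc G s (inj₁ (src {G = G} e)) (inj₂ (e , i))
  step   : (e : Edge G) (i j : Fin (s e)) → suc (toℕ i) ≡ toℕ j →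
           SubArc G s (inj₂ (e , i)) (inj₂ (e , j))
  finish : (e : Edge G) (i : Fin (s e)) → suc (toℕ i) ≡ s e →
           SubArc G s (inj₂ (e , i)) (inj₁ (tgt {G = G} e))

SubAdj : ∀ {n} (G : SimpleGraph n) (s : Edge G → ℕ) → SubV G s → SubV G s → Set
SubAdj G s x y = SubArc G s x y ⊎ SubArc G s y x

data Colour : Set where
  red blue : Colour

record Crumby {V : Set} (E : V → V → Set) (c : V → Colour) : Set where
  field
    blue-maxdeg≤1 : ∀ v w x → c v ≡ blue → c w ≡ blue → c x ≡ blue →
                    E v w → E v x → w ≡ x
    red-mindeg≥1  : ∀ v → c v ≡ red → ∃ λ w → c w ≡ red × E v w
    red-noP4      : ∀ a b d f → c a ≡ red → c b ≡ red → c d ≡ red → c f ≡ red →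
                    ¬ a ≡ b → ¬ a ≡ d → ¬ a ≡ f → ¬ b ≡ d → ¬ b ≡ f → ¬ d ≡ f →
                    E a b → E b d → E d f → ⊥

HasCrumby : {V : Set} (E : V → V → Set) → Set
HasCrumby {V} E = Σ (V → Colour) λ c → Crumby E c

-- Each branch vertex is classified by its immediate neighbourhood: S if it lies on an edge
-- subdivided four times, T if two edges subdivided twice lead to S-vertices, Bl otherwise.
-- S- and T-vertices are red, Bl-vertices blue. Every subdivided edge is coloured by a fixed word
-- that depends only on its length and the kinds of its ends (a finite table, with 3-periodic
-- families for long edges). The words satisfy the crumby conditions along the path, and their
-- first few letters make a red branch vertex the centre of a red star whose leaves have no other
-- red neighbour, and give a blue branch vertex a blue neighbour only on a doubly subdivided edge
-- to an S-vertex, of which it has at most one. The exception is a T-vertex with a doubly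
-- subdivided edge to a Bl-vertex: it ends a red path of three vertices along that edge, and
-- since the graph is cubic there is only one such edge.

module Submission where

open import Defs
open import Axiom.UniquenessOfIdentityProofs.WithK using (uip)
open import Data.Bool using (Bool; true; false; not; _∧_; T; if_then_else_)
import Data.Bool.Properties as Bool
open import Data.Bool.Properties using (∧-identityʳ)
open import Data.Empty using (⊥; ⊥-elim)
open import Data.Fin using (Fin; zero; suc; toℕ; fromℕ<)
open import Data.Fin.Properties
  using (<-cmp; <-asym; <-irrelevant; <-irrefl; any?; toℕ-fromℕ<; fromℕ<-toℕ; toℕ<n) renaming (_≟_ to _≟ᶠ_)
open import Data.List using (List; []; _∷_; _++_; length; tabulate)
open import Data.List.Properties using (length-++; map-tabulate)
open import Data.List.Relation.Unary.All as All using (All; []; _∷_)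
open import Data.List.Relation.Unary.Unique.Propositional using (Unique; []; _∷_)
open import Data.Nat using (ℕ; zero; suc; pred; _+_; _≤_; _<_; _<?_; z≤n; s≤s; >-nonZero)
open import Data.Nat.ListAction using (sum)
import Data.Nat.Properties as ℕ
open import Data.Nat.Properties using (+-comm; +-suc; ≤∧≮⇒≡; ≤-refl; ≤-reflexive)
open import Data.Product using (Σ; Σ-syntax; ∃; ∃-syntax; _×_; _,_; proj₁; proj₂)
open import Data.Sum using (_⊎_; inj₁; inj₂)
open import Data.Sum.Properties using (inj₁-injective; inj₂-injective)
open import Function using (_∘_; id)
open import Relation.Binary.Definitions using (tri<; tri≈; tri>)
open import Relation.Binary.PropositionalEquality
open import Relation.Nullary using (¬_; Dec; yes; no; does; map′; ¬?; _×-dec_; _→-dec_; T?; contradiction)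
open import Relation.Nullary.Decidable using (True; toWitness)
open ≡-Reasoning

-- Colour words along a path

R B : Colour
R = red
B = blue

infix 4 _≟ᶜ_
_≟ᶜ_ : (x y : Colour) → Dec (x ≡ y)
red  ≟ᶜ red  = yes refl
red  ≟ᶜ blue = no λ ()
blue ≟ᶜ red  = no λ ()
blue ≟ᶜ blue = yes refl

-- Reading past the end of a word gives blue; such positions never occur below.
infixl 10 _!_
_!_ : List Colour → ℕ → Colour
[]       ! _     = blue
(x ∷ _)  ! zero  = x
(_ ∷ xs) ! suc p = xs ! p

bothBlue : Colour → Colour → Bool
bothBlue blue blue = true
bothBlue _    _    = false

fourRed : Colour → Colour → Colour → List Colour → Bool
fourRed red red red (red ∷ _) = true
fourRed _   _   _   _         = false

-- The colours along a path, checked at its inner vertices: the two path neighbours of an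
-- inner vertex are never both blue (a blue vertex then has at most one blue neighbour, a red
-- one has a red neighbour), and no four consecutive vertices are red.
crumbyWord : List Colour → Bool
crumbyWord (x ∷ y ∷ z ∷ r) = not (bothBlue x z) ∧ not (fourRed x y z r) ∧ crumbyWord (y ∷ z ∷ r)
crumbyWord _               = true

crumbyWord-tail : ∀ x y z r → T (crumbyWord (x ∷ y ∷ z ∷ r)) → T (crumbyWord (y ∷ z ∷ r))
crumbyWord-tail x y z r ok with not (bothBlue x z) | not (fourRed x y z r)
... | true | true = ok

crumbyWord-neighbour : ∀ w p → T (crumbyWord w) → 2 + p < length w →
                       w ! p ≡ red ⊎ w ! (2 + p) ≡ red
crumbyWord-neighbour (red  ∷ _ ∷ _    ∷ _) zero _  _ = inj₁ refl
crumbyWord-neighbour (blue ∷ _ ∷ red  ∷ _) zero _  _ = inj₂ refl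
crumbyWord-neighbour (blue ∷ _ ∷ blue ∷ _) zero () _
crumbyWord-neighbour (x ∷ y ∷ z ∷ r) (suc p) ok (s≤s lt) =
  crumbyWord-neighbour (y ∷ z ∷ r) p (crumbyWord-tail x y z r ok) lt
crumbyWord-neighbour (_ ∷ []) zero _ (s≤s ())
crumbyWord-neighbour (_ ∷ _ ∷ []) _ _ (s≤s (s≤s ()))

crumbyWord-noFourRed : ∀ w p → T (crumbyWord w) → 3 + p < length w →
                       w ! p ≡ red → w ! (1 + p) ≡ red → w ! (2 + p) ≡ red → w ! (3 + p) ≢ red
crumbyWord-noFourRed (red ∷ red ∷ red ∷ red ∷ _) zero () _ refl refl refl refl
crumbyWord-noFourRed (x ∷ y ∷ z ∷ r) (suc p) ok (s≤s lt) =
  crumbyWord-noFourRed (y ∷ z ∷ r) p (crumbyWord-tail x y z r ok) lt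
crumbyWord-noFourRed (x ∷ y ∷ z ∷ []) zero _ (s≤s (s≤s (s≤s ())))
crumbyWord-noFourRed (x ∷ y ∷ []) (suc p) _ (s≤s (s≤s ()))

-- An end type fixes the colour of an end vertex of a subdivided edge and of the next one or
-- two vertices along the edge: in RRB the end vertex is the centre of a red star.
data End : Colour → Set where
  BR BB     : End blue
  RRB RB RR : End red

next : ∀ {c} → End c → Colour
next BR  = red
next BB  = blue
next RRB = red
next RB  = blue
next RR  = red

isCentre : ∀ {c} → End c → Bool
isCentre RRB = true
isCentre _   = false

padding : ℕ → List Colour
padding 0                   = []
padding 1                   = R ∷ []
padding 2                   = R ∷ B ∷ []
padding (suc (suc (suc n))) = B ∷ R ∷ R ∷ padding n

-- The colours of the k + 2 vertices along an edge subdivided k times with end types t₁ and t₂;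
-- the empty word for combinations that never occur.
word : ∀ {c₁ c₂} → End c₁ → End c₂ → ℕ → List Colour
word BR  BR  2 = B ∷ R ∷ R ∷ B ∷ []
word BR  BR  3 = B ∷ R ∷ R ∷ R ∷ B ∷ []
word BR  BR  (suc (suc (suc (suc (suc n))))) = B ∷ R ∷ R ∷ (padding n ++ B ∷ R ∷ R ∷ B ∷ [])
word BR  RB  (suc (suc (suc n))) = B ∷ R ∷ R ∷ (padding n ++ B ∷ R ∷ [])
word RB  BR  3 = R ∷ B ∷ R ∷ R ∷ B ∷ []
word RB  BR  5 = R ∷ B ∷ B ∷ R ∷ R ∷ R ∷ B ∷ []
word RB  BR  (suc (suc (suc (suc (suc (suc n)))))) = R ∷ B ∷ R ∷ R ∷ (padding n ++ B ∷ R ∷ R ∷ B ∷ [])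
word RB  RB  (suc (suc n)) = R ∷ B ∷ (padding n ++ B ∷ R ∷ [])
word BR  RR  2 = B ∷ R ∷ R ∷ R ∷ []
word RR  BR  2 = R ∷ R ∷ R ∷ B ∷ []
word BB  RRB 2 = B ∷ B ∷ R ∷ R ∷ []
word RRB BB  2 = R ∷ R ∷ B ∷ B ∷ []
word RRB RB  2 = R ∷ R ∷ B ∷ R ∷ []
word RB  RRB 2 = R ∷ B ∷ R ∷ R ∷ []
word RRB RRB 3 = R ∷ R ∷ B ∷ R ∷ R ∷ []
word RRB RRB 4 = R ∷ R ∷ B ∷ B ∷ R ∷ R ∷ []
word _   _   _ = []

record EdgeWord {c₁ c₂} (t₁ : End c₁) (t₂ : End c₂) (k : ℕ) (w : List Colour) : Set where
  field
    length≡     : length w ≡ 2 + k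
    crumby      : T (crumbyWord w)
    first       : w ! 0 ≡ c₁
    second      : w ! 1 ≡ next t₁
    third       : T (isCentre t₁) → w ! 2 ≡ blue
    last        : w ! suc k ≡ c₂
    penultimate : w ! k ≡ next t₂
    antepenult  : T (isCentre t₂) → w ! pred k ≡ blue

edgeWord? : ∀ {c₁ c₂} (t₁ : End c₁) (t₂ : End c₂) k w → Dec (EdgeWord t₁ t₂ k w)
edgeWord? {c₁} {c₂} t₁ t₂ k w =
  map′ (λ (a , b , c , d , e , f , g , h) → record
         { length≡ = a ; crumby = b ; first = c ; second = d ; third = e
         ; last = f ; penultimate = g ; antepenult = h })
       (λ ew → let open EdgeWord ew in
         length≡ , crumby , first , second , third , last , penultimate , antepenult)
       (length w ℕ.≟ 2 + k ×-dec T? (crumbyWord w) ×-dec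
        w ! 0 ≟ᶜ c₁ ×-dec w ! 1 ≟ᶜ next t₁ ×-dec (T? (isCentre t₁) →-dec w ! 2 ≟ᶜ blue) ×-dec
        w ! suc k ≟ᶜ c₂ ×-dec w ! k ≟ᶜ next t₂ ×-dec (T? (isCentre t₂) →-dec w ! pred k ≟ᶜ blue))

edgeWord-by-computation : ∀ {c₁ c₂} {t₁ : End c₁} {t₂ : End c₂} {k w} →
                          {ok : True (edgeWord? t₁ t₂ k w)} → EdgeWord t₁ t₂ k w
edgeWord-by-computation {ok = ok} = toWitness ok

length-padding : ∀ n → length (padding n) ≡ n
length-padding 0                   = refl
length-padding 1                   = refl
length-padding 2                   = refl
length-padding (suc (suc (suc n))) = cong (3 +_) (length-padding n)

length-padding-++ : ∀ n xs → length (padding n ++ xs) ≡ length xs + n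
length-padding-++ n xs = begin
  length (padding n ++ xs)      ≡⟨ length-++ (padding n) ⟩
  length (padding n) + length xs ≡⟨ cong (_+ length xs) (length-padding n) ⟩
  n + length xs                  ≡⟨ +-comm n (length xs) ⟩
  length xs + n                  ∎

++-! : ∀ xs ys j → (xs ++ ys) ! (length xs + j) ≡ ys ! j
++-! []       ys j = refl
++-! (x ∷ xs) ys j = ++-! xs ys j

padding-++-! : ∀ n xs j → (padding n ++ xs) ! (j + n) ≡ xs ! j
padding-++-! n xs j =
  subst (λ p → (padding n ++ xs) ! p ≡ xs ! j)
        (trans (cong (_+ j) (length-padding n)) (+-comm n j)) (++-! (padding n) xs j)

-- A block B R R inserted after B R R leaves every window of crumbyWord unchanged.
crumby-BRR-padding-BRRB : ∀ n → T (crumbyWord (B ∷ R ∷ R ∷ (padding n ++ B ∷ R ∷ R ∷ B ∷ [])))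
crumby-BRR-padding-BRRB 0                   = _
crumby-BRR-padding-BRRB 1                   = _
crumby-BRR-padding-BRRB 2                   = _
crumby-BRR-padding-BRRB (suc (suc (suc n))) = crumby-BRR-padding-BRRB n

crumby-BRR-padding-BR : ∀ n → T (crumbyWord (B ∷ R ∷ R ∷ (padding n ++ B ∷ R ∷ [])))
crumby-BRR-padding-BR 0                   = _
crumby-BRR-padding-BR 1                   = _
crumby-BRR-padding-BR 2                   = _
crumby-BRR-padding-BR (suc (suc (suc n))) = crumby-BRR-padding-BR n

edgeWord-BR-BR : ∀ n → EdgeWord BR BR (5 + n) (word BR BR (5 + n))
edgeWord-BR-BR n = record
  { length≡ = cong (3 +_) (length-padding-++ n _) ; crumby = crumby-BRR-padding-BRRB n
  ; first = refl ; second = refl ; third = λ ()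
  ; last = padding-++-! n _ 3 ; penultimate = padding-++-! n _ 2 ; antepenult = λ () }

edgeWord-BR-RB : ∀ n → EdgeWord BR RB (3 + n) (word BR RB (3 + n))
edgeWord-BR-RB n = record
  { length≡ = cong (3 +_) (length-padding-++ n _) ; crumby = crumby-BRR-padding-BR n
  ; first = refl ; second = refl ; third = λ ()
  ; last = padding-++-! n _ 1 ; penultimate = padding-++-! n _ 0 ; antepenult = λ () }

edgeWord-RB-BR : ∀ n → EdgeWord RB BR (5 + n) (word RB BR (5 + n))
edgeWord-RB-BR zero    = edgeWord-by-computation
edgeWord-RB-BR (suc n) = record
  { length≡ = cong (4 +_) (length-padding-++ n _) ; crumby = crumby-BRR-padding-BRRB n
  ; first = refl ; second = refl ; third = λ ()
  ; last = padding-++-! n _ 3 ; penultimate = padding-++-! n _ 2 ; antepenult = λ () }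

edgeWord-RB-RB : ∀ n → EdgeWord RB RB (5 + n) (word RB RB (5 + n))
edgeWord-RB-RB n = record
  { length≡ = cong (5 +_) (length-padding-++ n _) ; crumby = crumby-BRR-padding-BR n
  ; first = refl ; second = refl ; third = λ ()
  ; last = padding-++-! n _ 1 ; penultimate = padding-++-! n _ 0 ; antepenult = λ () }

-- Kinds of branch vertices and their edge words

-- S: on an edge subdivided four times. Otherwise T if two edges subdivided twice lead to
-- S-vertices, split into Te when moreover one subdivided twice leads to a Bl-vertex and Tc when
-- not. Bl: the rest.
data Kind : Set where
  S Tc Te Bl : Kind

colour : Kind → Colour
colour Bl = blue
colour _  = red

star : Bool → End red
star true  = RRB
star false = RB

centredS : Kind → ℕ → Bool
centredS Bl 2 = true
centredS Bl _ = false
centredS _  3 = true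
centredS _  4 = true
centredS _  _ = false

centredTc : Kind → ℕ → Bool
centredTc S  2 = true
centredTc Bl _ = false
centredTc _  3 = true
centredTc _  _ = false

-- The end type at the κ-end of an edge subdivided k times whose other end has kind κ′.
endAt : (κ : Kind) → Kind → ℕ → End (colour κ)
endAt Bl S  2 = BB
endAt Bl _  _ = BR
endAt S  κ′ k = star (centredS κ′ k)
endAt Tc κ′ k = star (centredTc κ′ k)
endAt Te Bl 2 = RR
endAt Te _  _ = RB

colour≡blue⇒Bl : ∀ κ → colour κ ≡ blue → κ ≡ Bl
colour≡blue⇒Bl Bl _ = refl

kindWord : Kind → Kind → ℕ → List Colour
kindWord κ₁ κ₂ k = word (endAt κ₁ κ₂ k) (endAt κ₂ κ₁ k) k

KindEdgeWord : Kind → Kind → ℕ → Set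
KindEdgeWord κ₁ κ₂ k = EdgeWord (endAt κ₁ κ₂ k) (endAt κ₂ κ₁ k) k (kindWord κ₁ κ₂ k)

record Admissible (κ κ′ : Kind) (k : ℕ) : Set where
  field
    four⇒S    : k ≡ 4 → κ ≡ S
    Te⇒short  : κ ≡ Te → k ≡ 2 × (κ′ ≡ S ⊎ κ′ ≡ Bl)
    Tc-Bl⇒long : κ ≡ Tc → κ′ ≡ Bl → k ≢ 2

open Admissible

Te-partner : ∀ {κ k} → Admissible Te κ k → κ ≡ S ⊎ κ ≡ Bl
Te-partner a = proj₂ (Te⇒short a refl)

Te-short : ∀ {κ k} → Admissible Te κ k → k ≡ 2
Te-short a = proj₁ (Te⇒short a refl)

kindEdgeWord-2 : ∀ κ₁ κ₂ → Admissible κ₁ κ₂ 2 → Admissible κ₂ κ₁ 2 → KindEdgeWord κ₁ κ₂ 2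
kindEdgeWord-2 Te Tc a _ with Te-partner a
... | inj₁ ()
... | inj₂ ()
kindEdgeWord-2 Te Te a _ with Te-partner a
... | inj₁ ()
... | inj₂ ()
kindEdgeWord-2 Tc Te _ a with Te-partner a
... | inj₁ ()
... | inj₂ ()
kindEdgeWord-2 Tc Bl a _ = ⊥-elim (Tc-Bl⇒long a refl refl refl)
kindEdgeWord-2 Bl Tc _ a = ⊥-elim (Tc-Bl⇒long a refl refl refl)
kindEdgeWord-2 Bl Bl _ _ = edgeWord-by-computation
kindEdgeWord-2 Bl S  _ _ = edgeWord-by-computation
kindEdgeWord-2 Bl Te _ _ = edgeWord-by-computation
kindEdgeWord-2 S  Bl _ _ = edgeWord-by-computation
kindEdgeWord-2 S  S  _ _ = edgeWord-by-computation
kindEdgeWord-2 S  Tc _ _ = edgeWord-by-computation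
kindEdgeWord-2 S  Te _ _ = edgeWord-by-computation
kindEdgeWord-2 Tc S  _ _ = edgeWord-by-computation
kindEdgeWord-2 Tc Tc _ _ = edgeWord-by-computation
kindEdgeWord-2 Te Bl _ _ = edgeWord-by-computation
kindEdgeWord-2 Te S  _ _ = edgeWord-by-computation

kindEdgeWord-3 : ∀ κ₁ κ₂ → Admissible κ₁ κ₂ 3 → Admissible κ₂ κ₁ 3 → KindEdgeWord κ₁ κ₂ 3
kindEdgeWord-3 Te _  a _ with Te-short a
... | ()
kindEdgeWord-3 _  Te _ a with Te-short a
... | ()
kindEdgeWord-3 Bl Bl _ _ = edgeWord-by-computation
kindEdgeWord-3 Bl S  _ _ = edgeWord-by-computation
kindEdgeWord-3 Bl Tc _ _ = edgeWord-by-computation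
kindEdgeWord-3 S  Bl _ _ = edgeWord-by-computation
kindEdgeWord-3 S  S  _ _ = edgeWord-by-computation
kindEdgeWord-3 S  Tc _ _ = edgeWord-by-computation
kindEdgeWord-3 Tc Bl _ _ = edgeWord-by-computation
kindEdgeWord-3 Tc S  _ _ = edgeWord-by-computation
kindEdgeWord-3 Tc Tc _ _ = edgeWord-by-computation

kindEdgeWord-5+ : ∀ κ₁ κ₂ n → Admissible κ₁ κ₂ (5 + n) → Admissible κ₂ κ₁ (5 + n) →
                  KindEdgeWord κ₁ κ₂ (5 + n)
kindEdgeWord-5+ Te _  _ a _ with Te-short a
... | ()
kindEdgeWord-5+ _  Te _ _ a with Te-short a
... | ()
kindEdgeWord-5+ Bl Bl n _ _ = edgeWord-BR-BR n
kindEdgeWord-5+ Bl S  n _ _ = edgeWord-BR-RB (2 + n)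
kindEdgeWord-5+ Bl Tc n _ _ = edgeWord-BR-RB (2 + n)
kindEdgeWord-5+ S  Bl n _ _ = edgeWord-RB-BR n
kindEdgeWord-5+ Tc Bl n _ _ = edgeWord-RB-BR n
kindEdgeWord-5+ S  S  n _ _ = edgeWord-RB-RB n
kindEdgeWord-5+ S  Tc n _ _ = edgeWord-RB-RB n
kindEdgeWord-5+ Tc S  n _ _ = edgeWord-RB-RB n
kindEdgeWord-5+ Tc Tc n _ _ = edgeWord-RB-RB n

kindEdgeWord : ∀ κ₁ κ₂ k → 2 ≤ k → Admissible κ₁ κ₂ k → Admissible κ₂ κ₁ k → KindEdgeWord κ₁ κ₂ k
kindEdgeWord _  _  1 (s≤s ())
kindEdgeWord κ₁ κ₂ 2 _ a₁ a₂ = kindEdgeWord-2 κ₁ κ₂ a₁ a₂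
kindEdgeWord κ₁ κ₂ 3 _ a₁ a₂ = kindEdgeWord-3 κ₁ κ₂ a₁ a₂
kindEdgeWord κ₁ κ₂ 4 _ a₁ a₂ with four⇒S a₁ refl | four⇒S a₂ refl
... | refl | refl = edgeWord-by-computation
kindEdgeWord κ₁ κ₂ (suc (suc (suc (suc (suc n))))) _ a₁ a₂ = kindEdgeWord-5+ κ₁ κ₂ n a₁ a₂

endAt-Bl-next-blue : ∀ κ k → next (endAt Bl κ k) ≡ blue → κ ≡ S × k ≡ 2
endAt-Bl-next-blue S  2                   _  = refl , refl
endAt-Bl-next-blue S  0                   ()
endAt-Bl-next-blue S  1                   ()
endAt-Bl-next-blue S  (suc (suc (suc _))) ()
endAt-Bl-next-blue Tc _                   ()
endAt-Bl-next-blue Te _                   ()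
endAt-Bl-next-blue Bl _                   ()

endAt-Te-next-red : ∀ κ k → next (endAt Te κ k) ≡ red → κ ≡ Bl × k ≡ 2
endAt-Te-next-red Bl 2                   _  = refl , refl
endAt-Te-next-red Bl 0                   ()
endAt-Te-next-red Bl 1                   ()
endAt-Te-next-red Bl (suc (suc (suc _))) ()
endAt-Te-next-red S  _                   ()
endAt-Te-next-red Tc _                   ()
endAt-Te-next-red Te _                   ()

endAt-Te-not-centre : ∀ κ k → ¬ T (isCentre (endAt Te κ k))
endAt-Te-not-centre Bl 2                   ()
endAt-Te-not-centre Bl 0                   ()
endAt-Te-not-centre Bl 1                   ()
endAt-Te-not-centre Bl (suc (suc (suc _))) ()
endAt-Te-not-centre S  _                   ()
endAt-Te-not-centre Tc _                   ()
endAt-Te-not-centre Te _                   ()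

star-next-red : ∀ b → next (star b) ≡ red → T (isCentre (star b))
star-next-red true  _  = _
star-next-red false ()

endAt-next-red : ∀ κ κ′ k → colour κ ≡ red → next (endAt κ κ′ k) ≡ red →
                 T (isCentre (endAt κ κ′ k)) ⊎ (κ ≡ Te × κ′ ≡ Bl × k ≡ 2)
endAt-next-red Bl _  _ () _
endAt-next-red S  κ′ k _ nr = inj₁ (star-next-red (centredS κ′ k) nr)
endAt-next-red Tc κ′ k _ nr = inj₁ (star-next-red (centredTc κ′ k) nr)
endAt-next-red Te κ′ k _ nr = inj₂ (refl , endAt-Te-next-red κ′ k nr)

-- Neighbours in a cubic graph

count : ∀ {m} → (Fin m → Bool) → ℕ
count f = sum (tabulate (λ x → if f x then 1 else 0))

count-cong : ∀ {m} {f g : Fin m → Bool} → (∀ x → f x ≡ g x) → count f ≡ count g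
count-cong {zero}  f≗g = refl
count-cong {suc m} f≗g = cong₂ (λ b c → (if b then 1 else 0) + c) (f≗g zero) (count-cong (f≗g ∘ suc))

remove : ∀ {m} → (Fin m → Bool) → Fin m → Fin m → Bool
remove f w x = f x ∧ not (does (x ≟ᶠ w))

count-remove : ∀ {m} (f : Fin m → Bool) w → f w ≡ true → count f ≡ suc (count (remove f w))
count-remove f zero fw rewrite fw = cong suc (count-cong (λ x → sym (∧-identityʳ (f (suc x)))))
count-remove f (suc w) fw rewrite count-remove (f ∘ suc) w fw | ∧-identityʳ (f zero) =
  +-suc (if f zero then 1 else 0) _

remove-keeps : ∀ {m} (f : Fin m → Bool) {w x} → f x ≡ true → w ≢ x → remove f w x ≡ true
remove-keeps f {w} {x} fx w≢x with x ≟ᶠ w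
... | yes x≡w = contradiction (sym x≡w) w≢x
... | no  _   rewrite fx = refl

unique-witnesses≤count : ∀ {m} (f : Fin m → Bool) {ws} → Unique ws → All (λ w → f w ≡ true) ws →
                         length ws ≤ count f
unique-witnesses≤count f []               []         = z≤n
unique-witnesses≤count f {w ∷ _} (w≢ ∷ u) (fw ∷ fws) =
  subst (_ ≤_) (sym (count-remove f w fw))
    (s≤s (unique-witnesses≤count (remove f w) u
            (All.zipWith (λ (fx , w≢x) → remove-keeps f fx w≢x) (fws , w≢))))

degree≡count : ∀ {n} (G : SimpleGraph n) v → degree G v ≡ count (adj G v)
degree≡count {n} G v = cong sum (map-tabulate id (λ w → if adj G v w then 1 else 0))

cubic-neighbours : ∀ {n} (G : SimpleGraph n) → Cubic G → ∀ {v a b c d} →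
                   adj G v a ≡ true → adj G v b ≡ true → adj G v c ≡ true → adj G v d ≡ true →
                   a ≢ b → a ≢ c → b ≢ c → d ≡ a ⊎ d ≡ b ⊎ d ≡ c
cubic-neighbours G cubic {v} {a} {b} {c} {d} va vb vc vd a≢b a≢c b≢c
  with d ≟ᶠ a | d ≟ᶠ b | d ≟ᶠ c
... | yes d≡a | _       | _       = inj₁ d≡a
... | no  _   | yes d≡b | _       = inj₂ (inj₁ d≡b)
... | no  _   | no  _   | yes d≡c = inj₂ (inj₂ d≡c)
... | no  d≢a | no  d≢b | no  d≢c with
  subst (4 ≤_) (trans (sym (degree≡count G v)) (cubic v))
    (unique-witnesses≤count (adj G v)
      ((a≢b ∷ a≢c ∷ (d≢a ∘ sym) ∷ []) ∷ (b≢c ∷ (d≢b ∘ sym) ∷ []) ∷ ((d≢c ∘ sym) ∷ []) ∷ [] ∷ [])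
      (va ∷ vb ∷ vc ∷ vd ∷ []))
... | s≤s (s≤s (s≤s ()))

module Edges {n} (G : SimpleGraph n) where

  tail head : Edge G → Fin n
  tail = src {G = G}
  head = tgt {G = G}

  data Joins (e : Edge G) : Fin n → Fin n → Set where
    forward  : Joins e (tail e) (head e)
    backward : Joins e (head e) (tail e)

  joins-sym : ∀ {e u w} → Joins e u w → Joins e w u
  joins-sym forward  = backward
  joins-sym backward = forward

  joins-adj : ∀ {e u w} → Joins e u w → adj G u w ≡ true
  joins-adj {_ , _ , _ , p} forward  = p
  joins-adj {u , w , _ , p} backward = trans (symm G w u) p

  joins-unique : ∀ {e e′ u w} → Joins e u w → Joins e′ u w → e ≡ e′
  joins-unique {u , w , lt , p} {_ , _ , lt′ , p′} forward forward =
    cong₂ (λ lt p → u , w , lt , p) (<-irrelevant lt lt′) (uip p p′)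
  joins-unique {u , w , lt , p} {_ , _ , lt′ , p′} backward backward =
    cong₂ (λ lt p → u , w , lt , p) (<-irrelevant lt lt′) (uip p p′)
  joins-unique {_ , _ , lt , _} {_ , _ , lt′ , _} forward  backward = contradiction lt′ (<-asym lt)
  joins-unique {_ , _ , lt , _} {_ , _ , lt′ , _} backward forward  = contradiction lt′ (<-asym lt)

  edgeBetween : ∀ u w → adj G u w ≡ true → Σ (Edge G) λ e → Joins e u w
  edgeBetween u w p with <-cmp u w
  ... | tri< u<w _ _ = (u , w , u<w , p) , forward
  ... | tri≈ _ refl _ = contradiction (trans (sym p) (irrefl G u)) λ ()
  ... | tri> _ _ w<u = (w , u , w<u , trans (symm G w u) p) , backward

module Subdivision {n} (G : SimpleGraph n) (s : Edge G → ℕ) where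

  open Edges G

  -- Position p on the path of e, counted from its tail: 0 is the tail and s e + 1 the head.
  vertexAt : Edge G → ℕ → SubV G s
  vertexAt e zero    = inj₁ (tail e)
  vertexAt e (suc p) with p <? s e
  ... | yes p<s = inj₂ (e , fromℕ< p<s)
  ... | no  _   = inj₁ (head e)

  vertexAt-inner : ∀ e {p} (p<s : p < s e) → vertexAt e (suc p) ≡ inj₂ (e , fromℕ< p<s)
  vertexAt-inner e {p} p<s with p <? s e
  ... | yes _   = refl
  ... | no  p≮s = contradiction p<s p≮s

  vertexAt-outer : ∀ e {p} → ¬ p < s e → vertexAt e (suc p) ≡ inj₁ (head e)
  vertexAt-outer e {p} p≮s with p <? s e
  ... | yes p<s = contradiction p<s p≮s
  ... | no  _   = refl

  vertexAt-toℕ : ∀ e (i : Fin (s e)) → vertexAt e (suc (toℕ i)) ≡ inj₂ (e , i)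
  vertexAt-toℕ e i = trans (vertexAt-inner e (toℕ<n i)) (cong (λ j → inj₂ (e , j)) (fromℕ<-toℕ i _))

  vertexAt-last : ∀ e → vertexAt e (suc (s e)) ≡ inj₁ (head e)
  vertexAt-last e = vertexAt-outer e (ℕ.<-irrefl refl)

  consecutive⇒arc : ∀ e {p} → p ≤ s e → SubArc G s (vertexAt e p) (vertexAt e (suc p))
  consecutive⇒arc e {zero} _ with 0 <? s e
  ... | yes 0<s = start e (fromℕ< 0<s) (toℕ-fromℕ< 0<s)
  ... | no  0≮s = direct e (sym (≤∧≮⇒≡ z≤n 0≮s))
  consecutive⇒arc e {suc p} p<s with suc p <? s e
  ... | yes p+1<s = subst (λ x → SubArc G s x _) (sym (vertexAt-inner e p<s))
                      (step e (fromℕ< p<s) (fromℕ< p+1<s)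
                        (trans (cong suc (toℕ-fromℕ< p<s)) (sym (toℕ-fromℕ< p+1<s))))
  ... | no  p+1≮s = subst (λ x → SubArc G s x _) (sym (vertexAt-inner e p<s))
                      (finish e (fromℕ< p<s) (trans (cong suc (toℕ-fromℕ< p<s)) (≤∧≮⇒≡ p<s p+1≮s)))

  arc⇒consecutive : ∀ {x y} → SubArc G s x y →
                    Σ[ e ∈ Edge G ] Σ[ p ∈ ℕ ] p ≤ s e × x ≡ vertexAt e p × y ≡ vertexAt e (suc p)
  arc⇒consecutive (direct e s≡0) =
    e , 0 , z≤n , refl , sym (vertexAt-outer e λ 0<s → ℕ.<-irrefl (sym s≡0) 0<s)
  arc⇒consecutive (start e i i≡0) =
    e , 0 , z≤n , refl , sym (subst (λ p → vertexAt e (suc p) ≡ _) i≡0 (vertexAt-toℕ e i))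
  arc⇒consecutive (step e i j i+1≡j) =
    e , suc (toℕ i) , toℕ<n i , sym (vertexAt-toℕ e i) ,
    sym (subst (λ p → vertexAt e (suc p) ≡ _) (sym i+1≡j) (vertexAt-toℕ e j))
  arc⇒consecutive (finish e i i+1≡s) =
    e , suc (toℕ i) , ≤-reflexive i+1≡s , sym (vertexAt-toℕ e i) ,
    sym (subst (λ p → vertexAt e (suc p) ≡ inj₁ (head e)) (sym i+1≡s) (vertexAt-last e))

  inner-not-branch : ∀ e {p u} → p < s e → vertexAt e (suc p) ≢ inj₁ u
  inner-not-branch e p<s eq with () ← trans (sym (vertexAt-inner e p<s)) eq

  inner-injective : ∀ e e′ {p q} → p < s e → vertexAt e (suc p) ≡ vertexAt e′ q → e ≡ e′ × suc p ≡ q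
  inner-injective e e′ {p} {zero}  p<s eq = contradiction eq (inner-not-branch e p<s)
  inner-injective e e′ {p} {suc q} p<s eq with q <? s e′
  ... | no  _   = contradiction eq (inner-not-branch e p<s)
  ... | yes q<s = cong proj₁ same , cong suc (begin
    p                        ≡⟨ toℕ-fromℕ< p<s ⟨
    toℕ (fromℕ< p<s)         ≡⟨ cong (λ x → toℕ (proj₂ x)) same ⟩
    toℕ (fromℕ< q<s)         ≡⟨ toℕ-fromℕ< q<s ⟩
    q                        ∎)
    where same = inj₂-injective (trans (sym (vertexAt-inner e p<s)) eq)

  inner-neighbours : ∀ e {i y} → i < s e → SubAdj G s (vertexAt e (suc i)) y →
                     y ≡ vertexAt e i ⊎ y ≡ vertexAt e (suc (suc i))
  inner-neighbours e i<s (inj₁ arc) with arc⇒consecutive arc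
  ... | e′ , q , _ , x≡ , y≡ with inner-injective e e′ {q = q} i<s x≡
  ... | refl , refl = inj₂ y≡
  inner-neighbours e i<s (inj₂ arc) with arc⇒consecutive arc
  ... | e′ , q , _ , y≡ , x≡ with inner-injective e e′ {q = suc q} i<s x≡
  ... | refl , refl = inj₁ y≡

  data Spoke : Fin n → Edge G → SubV G s → Set where
    from-tail : ∀ e → Spoke (tail e) e (vertexAt e 1)
    from-head : ∀ e → Spoke (head e) e (vertexAt e (s e))

  branch-neighbours : ∀ {u y} → SubAdj G s (inj₁ u) y → Σ[ e ∈ Edge G ] Spoke u e y
  branch-neighbours (inj₁ arc) with arc⇒consecutive arc
  ... | e , zero  , _   , refl , refl = e , from-tail e
  ... | e , suc q , q<s , u≡   , _    = contradiction (sym u≡) (inner-not-branch e q<s)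
  branch-neighbours (inj₂ arc) with arc⇒consecutive arc
  ... | e , q , q≤s , refl , u≡ =
    e , spoke (inj₁-injective (trans u≡ (vertexAt-outer e q≮s))) (≤∧≮⇒≡ q≤s q≮s)
    where
    q≮s = λ q<s → inner-not-branch e q<s (sym u≡)
    spoke : ∀ {u} → u ≡ head e → q ≡ s e → Spoke u e (vertexAt e q)
    spoke refl refl = from-head e

  last-neighbours : ∀ e {z} → 0 < s e → SubAdj G s (vertexAt e (s e)) z →
                    z ≡ vertexAt e (pred (s e)) ⊎ z ≡ inj₁ (head e)
  last-neighbours e {z} 0<s yz = go (ℕ.suc-pred (s e) {{>-nonZero 0<s}})
    where
    go : suc (pred (s e)) ≡ s e → z ≡ vertexAt e (pred (s e)) ⊎ z ≡ inj₁ (head e)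
    go s≡ with inner-neighbours e (subst (pred (s e) <_) s≡ ≤-refl)
                 (subst (λ p → SubAdj G s (vertexAt e p) z) (sym s≡) yz)
    ... | inj₁ z≡ = inj₁ z≡
    ... | inj₂ z≡ = inj₂ (trans z≡ (trans (cong (λ p → vertexAt e (suc p)) s≡) (vertexAt-last e)))

  inner⇒< : ∀ e {q x} → vertexAt e (suc q) ≡ inj₂ x → q < s e
  inner⇒< e {q} eq with q <? s e
  inner⇒< e _  | yes q<s = q<s
  inner⇒< e () | no  _

  far : ∀ {u e y} → Spoke u e y → Fin n
  far (from-tail e) = head e
  far (from-head e) = tail e

  spoke-joins : ∀ {u e y} (sp : Spoke u e y) → Joins e u (far sp)
  spoke-joins (from-tail e) = forward
  spoke-joins (from-head e) = backward

  spoke-functional : ∀ {u e y y′} → Spoke u e y → Spoke u e y′ → y ≡ y′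
  spoke-functional                      (from-tail _) (from-tail _) = refl
  spoke-functional                      (from-head _) (from-head _) = refl
  spoke-functional {e = _ , _ , lt , _} (from-tail _) (from-head _) = contradiction lt (<-irrefl refl)
  spoke-functional {e = _ , _ , lt , _} (from-head _) (from-tail _) = contradiction lt (<-irrefl refl)

  spoke-unique : ∀ {u e e′ y y′} (sp : Spoke u e y) (sp′ : Spoke u e′ y′) → far sp ≡ far sp′ → y ≡ y′
  spoke-unique sp sp′ eq with joins-unique (spoke-joins sp) (subst (Joins _ _) (sym eq) (spoke-joins sp′))
  ... | refl = spoke-functional sp sp′

  spoke-toward : ∀ {u o} → adj G u o ≡ true →
                 Σ[ e ∈ Edge G ] Σ[ y ∈ SubV G s ] SubAdj G s (inj₁ u) y × Σ[ sp ∈ Spoke u e y ] far sp ≡ o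
  spoke-toward {u} {o} p with edgeBetween u o p
  ... | e , forward  = e , vertexAt e 1 , inj₁ (consecutive⇒arc e z≤n) , from-tail e , refl
  ... | e , backward = e , vertexAt e (s e) ,
                       inj₂ (subst (SubArc G s _) (vertexAt-last e) (consecutive⇒arc e ≤-refl)) ,
                       from-head e , refl

module Kinds {n} (G : SimpleGraph n) (s : Edge G → ℕ) where

  open Edges G

  lengthBetween : ∀ u w {b} → adj G u w ≡ b → ℕ
  lengthBetween u w {true}  p = s (proj₁ (edgeBetween u w p))
  lengthBetween u w {false} _ = 0

  -- The number of vertices subdividing the edge between u and w (0 if there is none).
  ℓ : Fin n → Fin n → ℕ
  ℓ u w = lengthBetween u w refl

  ℓ-joins : ∀ {e u w} → Joins e u w → ℓ u w ≡ s e
  ℓ-joins {e} {u} {w} j = go refl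
    where
    go : ∀ {b} (p : adj G u w ≡ b) → lengthBetween u w p ≡ s e
    go {true}  p = cong s (joins-unique (proj₂ (edgeBetween u w p)) j)
    go {false} p = contradiction (trans (sym (joins-adj j)) p) λ ()

  ℓ-sym : ∀ {u w} → adj G u w ≡ true → ℓ u w ≡ ℓ w u
  ℓ-sym {u} {w} p with edgeBetween u w p
  ... | e , j = trans (ℓ-joins j) (sym (ℓ-joins (joins-sym j)))

  Short : Fin n → Fin n → Set
  Short u w = adj G u w ≡ true × ℓ u w ≡ 2

  IsS IsT IsBl IsE : Fin n → Set
  IsS  v = ∃[ w ] adj G v w ≡ true × ℓ v w ≡ 4
  IsT  v = ∃[ w₁ ] ∃[ w₂ ] w₁ ≢ w₂ × (Short v w₁ × IsS w₁) × (Short v w₂ × IsS w₂)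
  IsBl v = ¬ IsS v × ¬ IsT v
  IsE  v = ∃[ w ] Short v w × IsBl w

  short? : ∀ u w → Dec (Short u w)
  short? u w = adj G u w Bool.≟ true ×-dec ℓ u w ℕ.≟ 2

  IsS? : ∀ v → Dec (IsS v)
  IsS? v = any? λ w → adj G v w Bool.≟ true ×-dec ℓ v w ℕ.≟ 4
  IsT? : ∀ v → Dec (IsT v)
  IsT? v = any? λ w₁ → any? λ w₂ →
           ¬? (w₁ ≟ᶠ w₂) ×-dec (short? v w₁ ×-dec IsS? w₁) ×-dec (short? v w₂ ×-dec IsS? w₂)
  IsE? : ∀ v → Dec (IsE v)
  IsE? v = any? λ w → short? v w ×-dec ¬? (IsS? w) ×-dec ¬? (IsT? w)

  kind : Fin n → Kind
  kind v with IsS? v | IsT? v | IsE? v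
  ... | yes _ | _     | _     = S
  ... | no  _ | yes _ | no  _ = Tc
  ... | no  _ | yes _ | yes _ = Te
  ... | no  _ | no  _ | _     = Bl

  Spec : Fin n → Kind → Set
  Spec v S  = IsS v
  Spec v Tc = ¬ IsS v × IsT v × ¬ IsE v
  Spec v Te = ¬ IsS v × IsT v × IsE v
  Spec v Bl = IsBl v

  kind-spec : ∀ v → Spec v (kind v)
  kind-spec v with IsS? v | IsT? v | IsE? v
  ... | yes s | _     | _     = s
  ... | no ¬s | yes t | no ¬e = ¬s , t , ¬e
  ... | no ¬s | yes t | yes e = ¬s , t , e
  ... | no ¬s | no ¬t | _     = ¬s , ¬t

  spec : ∀ {v κ} → kind v ≡ κ → Spec v κ
  spec {v} refl = kind-spec v

  kind-S : ∀ {v} → IsS v → kind v ≡ S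
  kind-S {v} isS with kind v | kind-spec v
  ... | S  | _      = refl
  ... | Tc | ¬s , _ = contradiction isS ¬s
  ... | Te | ¬s , _ = contradiction isS ¬s
  ... | Bl | ¬s , _ = contradiction isS ¬s

  kind-Bl : ∀ {v} → IsBl v → kind v ≡ Bl
  kind-Bl {v} (¬s , ¬t) with kind v | kind-spec v
  ... | S  | s         = contradiction s ¬s
  ... | Tc | _ , t , _ = contradiction t ¬t
  ... | Te | _ , t , _ = contradiction t ¬t
  ... | Bl | _         = refl

  red⇒red-spoke : ∀ u → colour (kind u) ≡ red →
            ∃[ o ] adj G u o ≡ true × next (endAt (kind u) (kind o) (ℓ u o)) ≡ red
  red⇒red-spoke u c with kind u | kind-spec u
  red⇒red-spoke u () | Bl | _
  ... | S  | w , p , ℓ≡4 =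
    w , p , subst₂ (λ κ k → next (endAt S κ k) ≡ red)
                   (sym (kind-S (u , trans (symm G w u) p , trans (sym (ℓ-sym p)) ℓ≡4))) (sym ℓ≡4) refl
  ... | Tc | _ , (w , _ , _ , ((p , ℓ≡2) , isS) , _) , _ =
    w , p , subst₂ (λ κ k → next (endAt Tc κ k) ≡ red) (sym (kind-S isS)) (sym ℓ≡2) refl
  ... | Te | _ , _ , (w , (p , ℓ≡2) , isBl) =
    w , p , subst₂ (λ κ k → next (endAt Te κ k) ≡ red) (sym (kind-Bl isBl)) (sym ℓ≡2) refl

-- The colouring

module Colouring {n} (G : SimpleGraph n) (cubic : Cubic G) (s : Edge G → ℕ) (s≥2 : ∀ e → 2 ≤ s e) where

  open Edges G
  open Subdivision G s
  open Kinds G s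

  Te-neighbourhood : ∀ {u} → kind u ≡ Te →
    ∃[ b ] Short u b × IsBl b × (∀ {o} → adj G u o ≡ true → (Short u o × IsS o) ⊎ o ≡ b)
  Te-neighbourhood {u} eq with spec eq
  ... | _ , (w₁ , w₂ , w₁≢w₂ , (sh₁ , s₁) , (sh₂ , s₂)) , (b , shb , isBl) =
    b , shb , isBl , λ p → neighbour (cubic-neighbours G cubic (proj₁ sh₁) (proj₁ sh₂) (proj₁ shb) p
                                        w₁≢w₂ (S≢Bl s₁) (S≢Bl s₂))
    where
    S≢Bl : ∀ {w} → IsS w → w ≢ b
    S≢Bl isS refl = proj₁ isBl isS
    neighbour : ∀ {o} → o ≡ w₁ ⊎ o ≡ w₂ ⊎ o ≡ b → (Short _ o × IsS o) ⊎ o ≡ b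
    neighbour (inj₁ refl)        = inj₁ (sh₁ , s₁)
    neighbour (inj₂ (inj₁ refl)) = inj₁ (sh₂ , s₂)
    neighbour (inj₂ (inj₂ o≡b))  = inj₂ o≡b

  admissible : ∀ {u o} → adj G u o ≡ true → Admissible (kind u) (kind o) (ℓ u o)
  admissible {u} {o} p = record
    { four⇒S     = λ ℓ≡4 → kind-S (o , p , ℓ≡4)
    ; Te⇒short   = Te-case
    ; Tc-Bl⇒long = λ u-Tc o-Bl ℓ≡2 → proj₂ (proj₂ (spec u-Tc)) (o , (p , ℓ≡2) , spec o-Bl)
    }
    where
    Te-case : kind u ≡ Te → ℓ u o ≡ 2 × (kind o ≡ S ⊎ kind o ≡ Bl)
    Te-case u-Te with Te-neighbourhood u-Te
    ... | b , (_ , ℓ≡2) , isBl , nbh with nbh p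
    ...   | inj₁ ((_ , ℓ≡2′) , isS) = ℓ≡2′ , inj₁ (kind-S isS)
    ...   | inj₂ refl               = ℓ≡2 , inj₂ (kind-Bl isBl)

  Te-Bl-unique : ∀ {u a b} → kind u ≡ Te → Short u a → kind a ≡ Bl → Short u b → kind b ≡ Bl → a ≡ b
  Te-Bl-unique u-Te (pa , _) a-Bl (pb , _) b-Bl with Te-neighbourhood u-Te
  ... | c , _ , _ , nbh = trans (only pa a-Bl) (sym (only pb b-Bl))
    where
    only : ∀ {o} → adj G _ o ≡ true → kind o ≡ Bl → o ≡ c
    only p o-Bl with nbh p
    ... | inj₁ (_ , isS) with () ← trans (sym (kind-S isS)) o-Bl
    ... | inj₂ o≡c = o≡c

  edgeWordOf : Edge G → List Colour
  edgeWordOf e = kindWord (kind (tail e)) (kind (head e)) (s e)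

  validEdgeWord : ∀ e → KindEdgeWord (kind (tail e)) (kind (head e)) (s e)
  validEdgeWord e = kindEdgeWord _ _ (s e) (s≥2 e) (admissible-along forward) (admissible-along backward)
    where
    admissible-along : ∀ {u w} → Joins e u w → Admissible (kind u) (kind w) (s e)
    admissible-along j = subst (Admissible _ _) (ℓ-joins j) (admissible (joins-adj j))

  colourOf : SubV G s → Colour
  colourOf (inj₁ v)       = colour (kind v)
  colourOf (inj₂ (e , i)) = edgeWordOf e ! suc (toℕ i)

  colour-vertexAt : ∀ e {p} → p ≤ suc (s e) → colourOf (vertexAt e p) ≡ edgeWordOf e ! p
  colour-vertexAt e {zero}  _ = sym (EdgeWord.first (validEdgeWord e))
  colour-vertexAt e {suc q} q≤s with q <? s e
  ... | yes q<s = cong (λ j → edgeWordOf e ! suc j) (toℕ-fromℕ< q<s)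
  ... | no  q≮s rewrite ≤∧≮⇒≡ (ℕ.≤-pred q≤s) q≮s = sym (EdgeWord.last (validEdgeWord e))

  inner-neighbour-red : ∀ e {i} → i < s e →
                        colourOf (vertexAt e i) ≡ red ⊎ colourOf (vertexAt e (2 + i)) ≡ red
  inner-neighbour-red e {i} i<s
    with crumbyWord-neighbour (edgeWordOf e) i (EdgeWord.crumby (validEdgeWord e))
           (subst (2 + i <_) (sym (EdgeWord.length≡ (validEdgeWord e))) (s≤s (s≤s i<s)))
  ... | inj₁ r = inj₁ (trans (colour-vertexAt e (ℕ.m≤n⇒m≤1+n (ℕ.<⇒≤ i<s))) r)
  ... | inj₂ r = inj₂ (trans (colour-vertexAt e (s≤s i<s)) r)

  no-red-run : ∀ e q → 3 + q ≤ suc (s e) →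
               colourOf (vertexAt e q) ≡ red → colourOf (vertexAt e (1 + q)) ≡ red →
               colourOf (vertexAt e (2 + q)) ≡ red → colourOf (vertexAt e (3 + q)) ≢ red
  no-red-run e q le c₀ c₁ c₂ c₃ =
    crumbyWord-noFourRed (edgeWordOf e) q (EdgeWord.crumby (validEdgeWord e))
      (subst (3 + q <_) (sym (EdgeWord.length≡ (validEdgeWord e))) (s≤s le))
      (at c₀ (ℕ.≤-trans (ℕ.m≤n+m q 3) le)) (at c₁ (ℕ.≤-trans (ℕ.m≤n+m (1 + q) 2) le))
      (at c₂ (ℕ.≤-trans (ℕ.n≤1+n (2 + q)) le)) (at c₃ le)
    where
    at : ∀ {p} → colourOf (vertexAt e p) ≡ red → p ≤ suc (s e) → edgeWordOf e ! p ≡ red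
    at c p≤ = trans (sym (colour-vertexAt e p≤)) c

  s>0 : ∀ e → 0 < s e
  s>0 e = ℕ.<-≤-trans (s≤s z≤n) (s≥2 e)

  spokeEnd : ∀ {u e y} → Spoke u e y → End (colour (kind u))
  spokeEnd {u} {e} sp = endAt (kind u) (kind (far sp)) (s e)

  spoke-colour : ∀ {u e y} (sp : Spoke u e y) → colourOf y ≡ next (spokeEnd sp)
  spoke-colour (from-tail e) = trans (colour-vertexAt e (s≤s z≤n)) (EdgeWord.second (validEdgeWord e))
  spoke-colour (from-head e) =
    trans (colour-vertexAt e (ℕ.n≤1+n (s e))) (EdgeWord.penultimate (validEdgeWord e))

  centre-spoke-neighbour-blue : ∀ {u e y} (sp : Spoke u e y) → T (isCentre (spokeEnd sp)) →
                ∀ {z} → SubAdj G s y z → z ≢ inj₁ u → colourOf z ≡ blue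
  centre-spoke-neighbour-blue (from-tail e) centre yz z≢u with inner-neighbours e (s>0 e) yz
  ... | inj₁ refl = contradiction refl z≢u
  ... | inj₂ refl =
    trans (colour-vertexAt e (ℕ.≤-trans (s≥2 e) (ℕ.n≤1+n _))) (EdgeWord.third (validEdgeWord e) centre)
  centre-spoke-neighbour-blue (from-head e) centre yz z≢u with last-neighbours e (s>0 e) yz
  ... | inj₁ refl =
    trans (colour-vertexAt e (ℕ.≤-trans ℕ.pred[n]≤n (ℕ.n≤1+n _))) (EdgeWord.antepenult (validEdgeWord e) centre)
  ... | inj₂ refl = contradiction refl z≢u

  inner-not-both-blue : ∀ e {i} → i < s e →
                        colourOf (vertexAt e i) ≡ blue → colourOf (vertexAt e (2 + i)) ≡ blue → ⊥
  inner-not-both-blue e i<s b₀ b₂ with inner-neighbour-red e i<s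
  ... | inj₁ r with () ← trans (sym r) b₀
  ... | inj₂ r with () ← trans (sym r) b₂

  adj-sym : ∀ {x y} → SubAdj G s x y → SubAdj G s y x
  adj-sym (inj₁ arc) = inj₂ arc
  adj-sym (inj₂ arc) = inj₁ arc

  from-inner : ∀ {e i y} → SubAdj G s (inj₂ (e , i)) y → SubAdj G s (vertexAt e (suc (toℕ i))) y
  from-inner {e} {i} = subst (λ v → SubAdj G s v _) (sym (vertexAt-toℕ e i))

  blue-spoke : ∀ {u e y} (sp : Spoke u e y) → kind u ≡ Bl → colourOf y ≡ blue →
               Short u (far sp) × IsS (far sp)
  blue-spoke {u} {e} sp u-Bl cy
    with endAt-Bl-next-blue (kind (far sp)) (s e)
           (subst (λ κ → next (endAt κ (kind (far sp)) (s e)) ≡ blue) u-Bl (trans (sym (spoke-colour sp)) cy))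
  ... | far-S , s≡2 = (joins-adj (spoke-joins sp) , trans (ℓ-joins (spoke-joins sp)) s≡2) , spec far-S

  blue-maxdeg : ∀ v w x → colourOf v ≡ blue → colourOf w ≡ blue → colourOf x ≡ blue →
                SubAdj G s v w → SubAdj G s v x → w ≡ x
  blue-maxdeg (inj₁ u) w x cu cw cx uw ux with branch-neighbours uw | branch-neighbours ux
  ... | _ , sp | _ , sp′ with far sp ≟ᶠ far sp′
  ...   | yes same  = spoke-unique sp sp′ same
  ...   | no  differ =
    contradiction (far sp , far sp′ , differ , blue-spoke sp u-Bl cw , blue-spoke sp′ u-Bl cx)
                  (proj₂ (spec u-Bl))
    where u-Bl = colour≡blue⇒Bl (kind u) cu
  blue-maxdeg (inj₂ (e , i)) w x _ cw cx vw vx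
    with inner-neighbours e (toℕ<n i) (from-inner vw) | inner-neighbours e (toℕ<n i) (from-inner vx)
  ... | inj₁ refl | inj₁ refl = refl
  ... | inj₂ refl | inj₂ refl = refl
  ... | inj₁ refl | inj₂ refl = ⊥-elim (inner-not-both-blue e (toℕ<n i) cw cx)
  ... | inj₂ refl | inj₁ refl = ⊥-elim (inner-not-both-blue e (toℕ<n i) cx cw)

  red-mindeg : ∀ v → colourOf v ≡ red → ∃[ w ] colourOf w ≡ red × SubAdj G s v w
  red-mindeg (inj₁ u) c with red⇒red-spoke u c
  ... | o , p , r with spoke-toward p
  ...   | e , y , uy , sp , refl =
    y , trans (spoke-colour sp)
              (subst (λ k → next (endAt (kind u) (kind (far sp)) k) ≡ red) (ℓ-joins (spoke-joins sp)) r) , uy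
  red-mindeg (inj₂ (e , i)) _ with inner-neighbour-red e (toℕ<n i)
  ... | inj₁ r = vertexAt e (toℕ i) , r ,
                 inj₂ (subst (SubArc G s _) (vertexAt-toℕ e i) (consecutive⇒arc e (ℕ.<⇒≤ (toℕ<n i))))
  ... | inj₂ r = vertexAt e (2 + toℕ i) , r ,
                 inj₁ (subst (λ v → SubArc G s v (vertexAt e (2 + toℕ i))) (vertexAt-toℕ e i)
                             (consecutive⇒arc e (toℕ<n i)))

  branch-not-middle : ∀ {u y₁ y₂ z} → SubAdj G s (inj₁ u) y₁ → SubAdj G s (inj₁ u) y₂ → SubAdj G s y₂ z →
                      y₁ ≢ y₂ → z ≢ inj₁ u → colourOf (inj₁ u) ≡ red →
                      colourOf y₁ ≡ red → colourOf y₂ ≡ red → colourOf z ≡ red → ⊥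
  branch-not-middle {u} uy₁ uy₂ y₂z y₁≢y₂ z≢u cu c₁ c₂ cz
    with branch-neighbours uy₁ | branch-neighbours uy₂
  ... | e₁ , sp₁ | e₂ , sp₂
    with endAt-next-red (kind u) (kind (far sp₂)) (s e₂) cu (trans (sym (spoke-colour sp₂)) c₂)
  ... | inj₁ centre with () ← trans (sym cz) (centre-spoke-neighbour-blue sp₂ centre y₂z z≢u)
  ... | inj₂ (u-Te , far₂-Bl , s₂≡2)
    with endAt-next-red (kind u) (kind (far sp₁)) (s e₁) cu (trans (sym (spoke-colour sp₁)) c₁)
  ...   | inj₁ centre =
    endAt-Te-not-centre (kind (far sp₁)) (s e₁)
      (subst (λ κ → T (isCentre (endAt κ (kind (far sp₁)) (s e₁)))) u-Te centre)
  ...   | inj₂ (_ , far₁-Bl , s₁≡2) =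
    y₁≢y₂ (spoke-unique sp₁ sp₂ (Te-Bl-unique u-Te (short sp₁ s₁≡2) far₁-Bl (short sp₂ s₂≡2) far₂-Bl))
    where
    short : ∀ {e y} (sp : Spoke u e y) → s e ≡ 2 → Short u (far sp)
    short sp s≡2 = joins-adj (spoke-joins sp) , trans (ℓ-joins (spoke-joins sp)) s≡2

  inner-not-middle : ∀ e {i a d f x} → i < s e →
                     SubAdj G s (vertexAt e (suc i)) a → SubAdj G s (vertexAt e (suc i)) d → SubAdj G s d f →
                     a ≢ d → f ≢ vertexAt e (suc i) → d ≡ inj₂ x → colourOf a ≡ red →
                     colourOf (vertexAt e (suc i)) ≡ red → colourOf d ≡ red → colourOf f ≡ red → ⊥
  inner-not-middle e {i} i<s ba bd df a≢d f≢b d-inner ca cb cd cf with inner-neighbours e i<s bd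
  ... | inj₂ refl with inner-neighbours e (inner⇒< e d-inner) df | inner-neighbours e i<s ba
  ...   | inj₁ refl | _         = f≢b refl
  ...   | inj₂ refl | inj₂ refl = a≢d refl
  ...   | inj₂ refl | inj₁ refl = no-red-run e i (s≤s (inner⇒< e d-inner)) ca cb cd cf
  inner-not-middle e {zero}  i<s ba bd df a≢d f≢b () ca cb cd cf | inj₁ refl
  inner-not-middle e {suc j} i<s ba bd df a≢d f≢b d-inner ca cb cd cf | inj₁ refl
    with inner-neighbours e (inner⇒< e d-inner) df | inner-neighbours e i<s ba
  ...   | inj₂ refl | _         = f≢b refl
  ...   | inj₁ refl | inj₁ refl = a≢d refl
  ...   | inj₁ refl | inj₂ refl = no-red-run e j (s≤s i<s) cf cd cb ca

  red-noP4 : ∀ a b d f → colourOf a ≡ red → colourOf b ≡ red → colourOf d ≡ red → colourOf f ≡ red →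
             a ≢ b → a ≢ d → a ≢ f → b ≢ d → b ≢ f → d ≢ f →
             SubAdj G s a b → SubAdj G s b d → SubAdj G s d f → ⊥
  red-noP4 a (inj₁ u) d f ca cb cd cf _ a≢d _ _ b≢f _ ab bd df =
    branch-not-middle (adj-sym ab) bd df a≢d (b≢f ∘ sym) cb ca cd cf
  red-noP4 a (inj₂ _) (inj₁ u) f ca cb cd cf _ a≢d _ _ b≢f _ ab bd df =
    branch-not-middle df (adj-sym bd) (adj-sym ab) (b≢f ∘ sym) a≢d cd cf cb ca
  red-noP4 a (inj₂ (e , i)) (inj₂ x) f ca cb cd cf _ a≢d _ _ b≢f _ ab bd df =
    inner-not-middle e (toℕ<n i) (from-inner (adj-sym ab)) (from-inner bd) df a≢d
      (λ f≡ → b≢f (sym (trans f≡ (vertexAt-toℕ e i)))) refl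
      ca (trans (cong colourOf (vertexAt-toℕ e i)) cb) cd cf

  crumby : Crumby (SubAdj G s) colourOf
  crumby = record { blue-maxdeg≤1 = blue-maxdeg ; red-mindeg≥1 = red-mindeg ; red-noP4 = red-noP4 }

lemma2p4 : (n : ℕ) (G : SimpleGraph n) → Cubic G →
    (s : Edge G → ℕ) → (∀ e → 2 ≤ s e) →
    HasCrumby (SubAdj G s)
lemma2p4 n G cubic s s≥2 = colourOf , crumby
  where open Colouring G cubic s s≥2
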